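{- Fix an integer $r\geq 2$. For every integer $d\geq 1$ there exists a triangle-free $d$-degenerate $r$-uniform hypergraph $G_d$ with chromatic number $d+1$ such that in every colouring of $G_d$ with $d+1$ colours, each of the $d+1$ colours is assigned to at least $r-1$ vertices.
   Context: A hypergraph $G$ consists of a set $V(G)$ of vertices and a set $E(G)$ of subsets of $V(G)$ called edges; it is $r$-uniform if every edge has exactly $r$ vertices. A hypergraph $H$ is a subhypergraph of $G$ if $V(H)\subseteq V(G)$ and $E(H)\subseteq E(G)$. The degree of a vertex $v$ is the number of edges containing $v$. A hypergraph is $d$-degenerate if every subhypergraph with at least one vertex has a vertex of degree at most $d$. A colouring of $G$ assigns one colour to each vertex so that no edge is monochromatic; the chromatic number is the minimum number of colours in a colouring. A triangle in an $r$-uniform hypergraph consists of three edges whose union is a set of exactly $r+1$ vertices; a hypergraph is triangle-free if it contains no triangle. -}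

module Defs where

open import Data.Nat using (ℕ; _≤_; _<_; _≥_; _∸_; _+_; suc)
open import Data.Fin using (Fin)
open import Data.Fin.Subset using (Subset; _∈_; _⊆_; ∣_∣; _∪_; Nonempty)
open import Data.Vec using (tabulate)
open import Data.Bool using (Bool; true; false; if_then_else_)
open import Data.Product using (Σ; ∃; _×_; _,_)
open import Relation.Binary.PropositionalEquality using (_≡_; _≢_)
open import Relation.Nullary using (¬_; does)
open import Function.Definitions using (Injective)
open import Data.Fin.Properties using (_≟_)
open import Data.Fin.Subset.Properties using (_∈?_)

record Hypergraph : Set where
  field
    n     : ℕ
    m     : ℕ
    edge  : Fin m → Subset n
    edge-inj : Injective _≡_ _≡_ edge
open Hypergraph public

Uniform : ℕ → Hypergraph → Set
Uniform r G = ∀ (i : Fin (m G)) → ∣ edge G i ∣ ≡ r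

IsSub : (G : Hypergraph) → Subset (n G) → Subset (m G) → Set
IsSub G S F = ∀ (i : Fin (m G)) → i ∈ F → edge G i ⊆ S

degreeIn : (G : Hypergraph) → Subset (m G) → Fin (n G) → ℕ
degreeIn G F v =
  ∣ tabulate (λ i → if does (i ∈? F) then does (v ∈? edge G i) else false) ∣

Degenerate : ℕ → Hypergraph → Set
Degenerate d G = ∀ (S : Subset (n G)) (F : Subset (m G)) → IsSub G S F →
  Nonempty S → ∃ λ v → v ∈ S × degreeIn G F v ≤ d

IsColouring : (G : Hypergraph) (k : ℕ) → (Fin (n G) → Fin k) → Set
IsColouring G k c = ∀ (i : Fin (m G)) →
  ¬ (∃ λ (col : Fin k) → ∀ v → v ∈ edge G i → c v ≡ col)

Colourable : Hypergraph → ℕ → Set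
Colourable G k = Σ (Fin (n G) → Fin k) (IsColouring G k)

ChromaticNumber : Hypergraph → ℕ → Set
ChromaticNumber G χ = Colourable G χ × (∀ j → j < χ → ¬ Colourable G j)

HasTriangle : ℕ → Hypergraph → Set
HasTriangle r G = Σ (Fin (m G)) λ a → Σ (Fin (m G)) λ b → Σ (Fin (m G)) λ c →
  a ≢ b × b ≢ c × a ≢ c ×
  ∣ edge G a ∪ (edge G b ∪ edge G c) ∣ ≡ r + 1

TriangleFree : ℕ → Hypergraph → Set
TriangleFree r G = ¬ HasTriangle r G

colourClass : (G : Hypergraph) {k : ℕ} → (Fin (n G) → Fin k) → Fin k → Subset (n G)
colourClass G c j = tabulate (λ v → does (c v ≟ j))

module Submission where

-- Induction on d for fixed r = s + 2; for d = 0 take r − 1 isolated vertices.  Given H for d, add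
-- N = (d + 2)·|V(H)|·(r − 1) + 1 fresh vertices and, for every injective way of placing |V(H)| disjoint
-- blocks of r − 1 fresh vertices, a copy of H in which each vertex w forms a new edge with its block.
-- Colouring fresh vertices 0 and each copy by 1 + (colouring of H) is proper.  In a (d + 2)-colouring,
-- by pigeonhole some colour j₀ fills a whole placement.  If j₀ is the colour j in question, one block
-- already has r − 1 vertices of colour j; otherwise the copy on that placement avoids j₀ (else an
-- attachment edge is monochromatic), so it is (d + 1)-coloured and the induction hypothesis applies.
-- Peeling the copies first and the (then isolated) fresh vertices last shows (d + 1)-degeneracy, and one
-- checks that any three edges still span at least r + 2 vertices.

open import Defs
open import Data.Bool using (true; false; if_then_else_)
open import Data.Empty using (⊥-elim)
open import Data.Fin as F
  using (Fin; zero; suc; _↑ˡ_; _↑ʳ_; splitAt; combine; remQuot; punchIn; punchOut)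
open import Data.Fin.Properties
  using ( _≟_; 0≢1+n; all?; any?; toℕ<n; toℕ-injective; toℕ-fromℕ; toℕ-fromℕ<; toℕ-inject≤
        ; inject≤-injective; suc-injective; ↑ˡ-injective; ↑ʳ-injective
        ; splitAt-↑ˡ; splitAt-↑ʳ; splitAt⁻¹-↑ˡ; splitAt⁻¹-↑ʳ
        ; combine-injective; combine-injectiveʳ; remQuot-combine; combine-remQuot
        ; punchOut-injective; punchIn-punchOut )
open import Data.Fin.Subset using (Subset; _∈_; ∣_∣; _∪_; _-_; Nonempty)
open import Data.Fin.Subset.Properties
  using (_∈?_; x∈p∪q⁺; x∈p∧x≢y⇒x∈p-y; x∈p⇒∣p-x∣<∣p∣)
open import Data.List as L using (List; []; _∷_; _++_; length; filter; allFin)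
open import Data.List.Properties using (length-map; length-++; length-tabulate)
open import Data.List.Membership.Propositional
  using () renaming (_∈_ to _∈ˡ_; _∉_ to _∉ˡ_)
open import Data.List.Membership.Propositional.Properties
  using ( ∈-map⁺; ∈-map⁻; ∈-++⁻; ∈-filter⁺; ∈-lookup; ∈-allFin; ∈-tabulate⁺; ∈-tabulate⁻
        ; ∈-concatMap⁺ )
open import Data.List.Relation.Unary.Any as Any using (here; there)
open import Data.List.Relation.Unary.Any.Properties using (lookup-index)
open import Data.List.Relation.Unary.All as All using (All; []; _∷_)
open import Data.List.Relation.Unary.All.Properties as AllP using (all-filter)
open import Data.List.Relation.Unary.Unique.Propositional using (Unique)
open import Data.List.Relation.Unary.AllPairs using ([]; _∷_)
open import Data.List.Relation.Unary.Unique.Propositional.Properties as UniqueP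
  using (allFin⁺; map⁺; ++⁺; tabulate⁺)
open import Data.List.Relation.Binary.Disjoint.Propositional using (Disjoint)
import Data.List.Relation.Binary.Sublist.Propositional.Properties as Sublist
open import Data.Nat as ℕ using (ℕ; zero; suc; _+_; _*_; _∸_; _≤_; _<_; _≥_; z≤n; s≤s)
open import Data.Nat.Properties
  using (≤-refl; ≤-trans; ≤-reflexive; <-irrefl; <-asym; ≤∧≢⇒<; ≰⇒>; m≤n⇒m≤1+n
        ; ≤-antisym; 1+n≰n; m≤n+m; +-comm; +-suc; +-mono-<-≤; <-≤-trans)
open import Data.Product using (Σ; ∃; ∃-syntax; _×_; _,_; proj₁; proj₂; uncurry)
open import Data.Sum using (_⊎_; inj₁; inj₂; [_,_]′)
open import Data.Vec as V using (Vec; tabulate)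
open import Data.Vec.Properties using (lookup∘tabulate; []=⇒lookup; lookup⇒[]=)
open import Function using (_∘_; const)
open import Function.Definitions using (Injective)
open import Relation.Nullary using (¬_; Dec; yes; no; does)
open import Relation.Nullary.Decidable using (dec-true; map′; _→-dec_)
import Relation.Unary as U
open import Relation.Unary.Properties using (∁?)
open import Relation.Binary.PropositionalEquality
  using (_≡_; _≢_; refl; sym; trans; cong; cong₂; subst; ≢-sym)

module _ {n : ℕ} {P : Fin n → Set} (P? : U.Decidable P) where

  ∈-select⁺ : ∀ {x} → P x → x ∈ tabulate (does ∘ P?)
  ∈-select⁺ {x} px = lookup⇒[]= x _ (trans (lookup∘tabulate _ x) (dec-true (P? x) px))

  ∈-select⁻ : ∀ {x} → x ∈ tabulate (does ∘ P?) → P x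
  ∈-select⁻ {x} x∈ with P? x | trans (sym (lookup∘tabulate (does ∘ P?) x)) ([]=⇒lookup x∈)
  ... | yes px | _ = px

_∈ˡ?_ : ∀ {n} (v : Fin n) (xs : List (Fin n)) → Dec (v ∈ˡ xs)
v ∈ˡ? xs = Any.any? (v ≟_) xs

fromList : ∀ {n} → List (Fin n) → Subset n
fromList xs = tabulate (does ∘ (_∈ˡ? xs))

∈-fromList⁺ : ∀ {n} {xs : List (Fin n)} {v} → v ∈ˡ xs → v ∈ fromList xs
∈-fromList⁺ {xs = xs} = ∈-select⁺ (_∈ˡ? xs)

∈-fromList⁻ : ∀ {n} {xs : List (Fin n)} {v} → v ∈ fromList xs → v ∈ˡ xs
∈-fromList⁻ {xs = xs} = ∈-select⁻ (_∈ˡ? xs)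

length≤∣p∣ : ∀ {n} {p : Subset n} {xs} → Unique xs → All (_∈ p) xs → length xs ≤ ∣ p ∣
length≤∣p∣ [] [] = z≤n
length≤∣p∣ {p = p} {x ∷ xs} (x∉xs ∷ xs!) (x∈p ∷ xs⊆p) =
  ≤-trans (s≤s (length≤∣p∣ xs! xs⊆p-x)) (x∈p⇒∣p-x∣<∣p∣ x∈p)
  where
  xs⊆p-x : All (_∈ p - x) xs
  xs⊆p-x = All.zipWith (λ (y∈p , x≢y) → x∈p∧x≢y⇒x∈p-y y∈p (≢-sym x≢y)) (xs⊆p , x∉xs)

predecessors : ∀ {n} → List (Fin (suc n)) → List (Fin n)
predecessors [] = []
predecessors (zero ∷ ys) = predecessors ys
predecessors (suc y ∷ ys) = y ∷ predecessors ys

length-predecessors : ∀ {n} (ys : List (Fin (suc n))) → length (predecessors ys) ≤ length ys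
length-predecessors [] = z≤n
length-predecessors (zero ∷ ys) = m≤n⇒m≤1+n (length-predecessors ys)
length-predecessors (suc y ∷ ys) = s≤s (length-predecessors ys)

zero∈⇒length-predecessors< : ∀ {n} (ys : List (Fin (suc n))) → zero ∈ˡ ys →
                             length (predecessors ys) < length ys
zero∈⇒length-predecessors< (zero ∷ ys) _ = s≤s (length-predecessors ys)
zero∈⇒length-predecessors< (suc y ∷ ys) (there z∈) = s≤s (zero∈⇒length-predecessors< ys z∈)

∈-predecessors⁺ : ∀ {n} {v : Fin n} (ys : List (Fin (suc n))) →
                  suc v ∈ˡ ys → v ∈ˡ predecessors ys
∈-predecessors⁺ (zero ∷ ys) (there v∈) = ∈-predecessors⁺ ys v∈
∈-predecessors⁺ (suc y ∷ ys) (here refl) = here refl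
∈-predecessors⁺ (suc y ∷ ys) (there v∈) = there (∈-predecessors⁺ ys v∈)

∣p∣≤length : ∀ {n} (p : Subset n) (ys : List (Fin n)) → (∀ {v} → v ∈ p → v ∈ˡ ys) →
             ∣ p ∣ ≤ length ys
∣p∣≤length V.[] ys p⊆ys = z≤n
∣p∣≤length (false V.∷ p) ys p⊆ys =
  ≤-trans (∣p∣≤length p (predecessors ys) (∈-predecessors⁺ ys ∘ p⊆ys ∘ V.there))
          (length-predecessors ys)
∣p∣≤length (true V.∷ p) ys p⊆ys =
  ≤-trans (s≤s (∣p∣≤length p (predecessors ys) (∈-predecessors⁺ ys ∘ p⊆ys ∘ V.there)))
          (zero∈⇒length-predecessors< ys (p⊆ys V.here))

∣fromList∣≡length : ∀ {n} {xs : List (Fin n)} → Unique xs → ∣ fromList xs ∣ ≡ length xs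
∣fromList∣≡length {xs = xs} xs! =
  ≤-antisym (∣p∣≤length (fromList xs) xs ∈-fromList⁻)
            (length≤∣p∣ xs! (All.tabulate ∈-fromList⁺))

∈-incident⁻ : ∀ (G : Hypergraph) F v {i} →
              i ∈ tabulate (λ i → if does (i ∈? F) then does (v ∈? edge G i) else false) →
              i ∈ F × v ∈ edge G i
∈-incident⁻ G F v {i} i∈
  with i ∈? F | v ∈? edge G i | trans (sym (lookup∘tabulate _ i)) ([]=⇒lookup i∈)
... | yes i∈F | yes v∈i | _ = i∈F , v∈i
... | yes _   | no _    | ()
... | no _    | _       | ()

AtLeast : {A : Set} → ℕ → (A → Set) → Set
AtLeast k P = ∃[ xs ] Unique xs × k ≤ length xs × All P xs

module _ {A : Set} where

  AtLeast-mono : ∀ {j k} {P Q : A → Set} → j ≤ k → (∀ {x} → P x → Q x) →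
                 AtLeast k P → AtLeast j Q
  AtLeast-mono j≤k P⇒Q (xs , xs! , k≤ , Pxs) = xs , xs! , ≤-trans j≤k k≤ , All.map P⇒Q Pxs

  AtLeast-++ : ∀ {xs ys : List A} → Unique xs → Unique ys → Disjoint xs ys →
               AtLeast (length xs + length ys) (λ v → v ∈ˡ xs ⊎ v ∈ˡ ys)
  AtLeast-++ {xs} {ys} xs! ys! xs#ys =
    xs ++ ys , ++⁺ xs! ys! xs#ys , ≤-reflexive (sym (length-++ xs)) , All.tabulate (∈-++⁻ xs)

  AtLeast-tabulate : ∀ {k} {P : A → Set} (f : Fin k → A) → Injective _≡_ _≡_ f →
                     (∀ i → P (f i)) → AtLeast k P
  AtLeast-tabulate f f-inj Pf =
    L.tabulate f , tabulate⁺ f-inj , ≤-reflexive (sym (length-tabulate f)) , AllP.tabulate⁺ Pf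

  AtLeast-map : ∀ {B : Set} {k} {P : A → Set} {Q : B → Set} (f : A → B) → Injective _≡_ _≡_ f →
                (∀ {x} → P x → Q (f x)) → AtLeast k P → AtLeast k Q
  AtLeast-map f f-inj P⇒Qf (xs , xs! , k≤ , Pxs) =
    L.map f xs , map⁺ f-inj xs! , subst (_ ≤_) (sym (length-map f xs)) k≤ ,
    AllP.map⁺ (All.map P⇒Qf Pxs)

  ∉⇒All≢ : ∀ {x : A} {xs} → x ∉ˡ xs → All (x ≢_) xs
  ∉⇒All≢ x∉ = All.tabulate (λ y∈ x≡y → x∉ (subst (_∈ˡ _) (sym x≡y) y∈))

  lookup-injective : ∀ {xs : List A} → Unique xs → ∀ i j → L.lookup xs i ≡ L.lookup xs j → i ≡ j
  lookup-injective (_ ∷ _) zero zero _ = refl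
  lookup-injective (x∉ ∷ _) zero (suc j) eq = ⊥-elim (All.lookup x∉ (∈-lookup j) eq)
  lookup-injective (x∉ ∷ _) (suc i) zero eq = ⊥-elim (All.lookup x∉ (∈-lookup i) (sym eq))
  lookup-injective (_ ∷ xs!) (suc i) (suc j) eq = cong suc (lookup-injective xs! i j eq)

  length-filter+∁ : ∀ {P : A → Set} (P? : U.Decidable P) xs →
                    length (filter P? xs) + length (filter (∁? P?) xs) ≡ length xs
  length-filter+∁ P? [] = refl
  length-filter+∁ P? (x ∷ xs) with P? x
  ... | yes _ = cong suc (length-filter+∁ P? xs)
  ... | no _ = trans (+-suc _ _) (cong suc (length-filter+∁ P? xs))

  pigeonhole : ∀ k q (c : A → ℕ) xs → All (λ x → c x < q) xs → q * k < length xs →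
               ∃[ j ] j < q × k ≤ length (filter (λ x → c x ℕ.≟ j) xs)
  pigeonhole k zero c (x ∷ xs) (() ∷ _) _
  pigeonhole k (suc q) c xs c<1+q big with k ℕ.≤? length (filter (λ x → c x ℕ.≟ q) xs)
  ... | yes enough = q , ≤-refl , enough
  ... | no few =
    let j , j<q , k≤ = pigeonhole k q c rest rest<q rest-big
    in j , m≤n⇒m≤1+n j<q ,
       ≤-trans k≤ (Sublist.length-mono-≤ (Sublist.filter⁺ _ _ (λ { refl cx≡j → cx≡j })
                                            (Sublist.filter-⊆ _ xs)))
    where
    is-q : U.Decidable (λ x → c x ≡ q)
    is-q x = c x ℕ.≟ q

    rest : List A
    rest = filter (∁? is-q) xs

    rest<q : All (λ x → c x < q) rest
    rest<q = All.zipWith (λ (cx<1+q , cx≢q) → ≤∧≢⇒< (ℕ.s≤s⁻¹ cx<1+q) cx≢q)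
                         (AllP.filter⁺ (∁? is-q) c<1+q , all-filter (∁? is-q) xs)

    rest-big : q * k < length rest
    rest-big = ≰⇒> λ rest≤ → <-asym big
      (subst (_< k + q * k) (length-filter+∁ is-q xs) (+-mono-<-≤ (≰⇒> few) rest≤))

vectors : ∀ {A : Set} → List A → ∀ k → List (Vec A k)
vectors xs zero = V.[] ∷ []
vectors xs (suc k) = L.concatMap (λ x → L.map (x V.∷_) (vectors xs k)) xs

∈-vectors : ∀ {A : Set} {xs : List A} → (∀ x → x ∈ˡ xs) →
            ∀ {k} (v : Vec A k) → v ∈ˡ vectors xs k
∈-vectors complete V.[] = here refl
∈-vectors complete (x V.∷ v) =
  ∈-concatMap⁺ _ (Any.map (λ { refl → ∈-map⁺ (x V.∷_) (∈-vectors complete v) }) (complete x))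

-- The inductive invariant

module _ {nV nE : ℕ} (E : Fin nE → List (Fin nV)) where

  Monochromatic : ∀ {q} → (Fin nV → Fin q) → Fin nE → Set
  Monochromatic c i = ∃[ col ] All (λ v → c v ≡ col) (E i)

  Spans : Subset nV → Subset nE → Set
  Spans S F = ∀ i → i ∈ F → All (_∈ S) (E i)

  DegreeAtMost : ℕ → Subset nE → Fin nV → Set
  DegreeAtMost d F v = ∃[ ys ] length ys ≤ d × (∀ i → i ∈ F → v ∈ˡ E i → i ∈ˡ ys)

-- Edges are duplicate-free lists.  E-spread is triangle-freeness in positive form: three distinct
-- r-edges span more than r vertices, and form no triangle iff they span at least r + 2 = s + 4.
record Robust (s d : ℕ) : Set where
  field
    nV nE            : ℕ
    E                : Fin nE → List (Fin nV)
    E-unique         : ∀ i → Unique (E i)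
    E-length         : ∀ i → length (E i) ≡ 2 + s
    E-separated      : ∀ i j → i ≢ j → ∃[ v ] v ∈ˡ E j × v ∉ˡ E i
    E-spread         : ∀ a b c → a ≢ b → b ≢ c → a ≢ c →
                       AtLeast (4 + s) (λ v → v ∈ˡ E a ⊎ v ∈ˡ E b ⊎ v ∈ˡ E c)
    degenerate       : ∀ S F → Spans E S F → Nonempty S → ∃[ v ] v ∈ S × DegreeAtMost E d F v
    colouring        : Fin nV → Fin (suc d)
    colouring-proper : ∀ i → ¬ Monochromatic E colouring i
    robust           : ∀ (c : Fin nV → Fin (suc d)) j →
                       AtLeast (suc s) (λ v → c v ≡ j) ⊎ ∃ (Monochromatic E c)
    vertex           : Fin nV

  E-nonempty : ∀ i → ∃[ v ] v ∈ˡ E i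
  E-nonempty i with E i | E-length i
  ... | v ∷ _ | _ = v , here refl

  E-pair : ∀ i → ∃[ u ] ∃[ v ] u ∈ˡ E i × v ∈ˡ E i × u ≢ v
  E-pair i with E i | E-length i | E-unique i
  ... | u ∷ v ∷ _ | _ | u∉ ∷ _ = u , v , here refl , there (here refl) , All.lookup u∉ (here refl)

module ToHypergraph {s d : ℕ} (H : Robust s d) where
  open Robust H

  hypergraph : Hypergraph
  hypergraph = record { n = nV ; m = nE ; edge = fromList ∘ E ; edge-inj = edge-injective }
    where
    edge-injective : Injective _≡_ _≡_ (fromList ∘ E)
    edge-injective {i} {j} Ei≡Ej with i ≟ j
    ... | yes i≡j = i≡j
    ... | no i≢j =
      let v , v∈Ej , v∉Ei = E-separated i j i≢j
      in ⊥-elim (v∉Ei (∈-fromList⁻ (subst (v ∈_) (sym Ei≡Ej) (∈-fromList⁺ v∈Ej))))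

  uniform : Uniform (2 + s) hypergraph
  uniform i = trans (∣fromList∣≡length (E-unique i)) (E-length i)

  triangleFree : TriangleFree (2 + s) hypergraph
  triangleFree (a , b , c , a≢b , b≢c , a≢c , ∣abc∣≡) =
    let xs , xs! , 4+s≤ , xs⊆abc = E-spread a b c a≢b b≢c a≢c
    in 1+n≰n (≤-trans 4+s≤ (≤-trans (length≤∣p∣ xs! (All.map ∈-union xs⊆abc))
                                    (≤-reflexive (trans ∣abc∣≡ (+-comm (2 + s) 1)))))
    where
    ∈-union : ∀ {v} → v ∈ˡ E a ⊎ v ∈ˡ E b ⊎ v ∈ˡ E c →
              v ∈ fromList (E a) ∪ (fromList (E b) ∪ fromList (E c))
    ∈-union (inj₁ v∈a) = x∈p∪q⁺ (inj₁ (∈-fromList⁺ v∈a))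
    ∈-union (inj₂ (inj₁ v∈b)) = x∈p∪q⁺ (inj₂ (x∈p∪q⁺ (inj₁ (∈-fromList⁺ v∈b))))
    ∈-union (inj₂ (inj₂ v∈c)) = x∈p∪q⁺ (inj₂ (x∈p∪q⁺ (inj₂ (∈-fromList⁺ v∈c))))

  degenerate′ : Degenerate d hypergraph
  degenerate′ S F F⊆S S≢∅ =
    let v , v∈S , ys , ys≤d , ys⊇ =
          degenerate S F (λ i i∈F → All.tabulate (F⊆S i i∈F ∘ ∈-fromList⁺)) S≢∅
    in v , v∈S ,
       ≤-trans (∣p∣≤length _ ys (λ {i} i∈ → let i∈F , v∈i = ∈-incident⁻ hypergraph F v i∈
                                          in ys⊇ i i∈F (∈-fromList⁻ v∈i)))
               ys≤d

  monochromatic : ∀ {q} {c : Fin nV → Fin q} {i col} →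
                  (∀ v → v ∈ edge hypergraph i → c v ≡ col) → Monochromatic E c i
  monochromatic {col = col} mono = col , All.tabulate (mono _ ∘ ∈-fromList⁺)

  colourable : Colourable hypergraph (suc d)
  colourable = colouring , λ i (col , mono) → colouring-proper i (monochromatic mono)

  not-colourable : ∀ j → j < suc d → ¬ Colourable hypergraph j
  not-colourable j (s≤s j≤d) (c , proper)
    with robust (λ v → F.inject≤ (c v) (m≤n⇒m≤1+n j≤d)) (F.fromℕ d)
  ... | inj₁ (v ∷ _ , _ , _ , cv≡d ∷ _) =
    <-irrefl refl (<-≤-trans (subst (_< j) d≡cv (toℕ<n (c v))) j≤d)
    where
    d≡cv : F.toℕ (c v) ≡ d
    d≡cv = trans (sym (toℕ-inject≤ (c v) _)) (trans (cong F.toℕ cv≡d) (toℕ-fromℕ d))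
  ... | inj₂ (i , col , mono) =
    let u , u∈i = E-nonempty i
    in proper i (c u , λ v v∈i → inject≤-injective _ _ _ _
                         (trans (All.lookup mono (∈-fromList⁻ v∈i)) (sym (All.lookup mono u∈i))))

  colourClasses-large : ∀ (c : Fin nV → Fin (suc d)) → IsColouring hypergraph (suc d) c →
                        ∀ j → suc s ≤ ∣ colourClass hypergraph c j ∣
  colourClasses-large c proper j with robust c j
  ... | inj₁ (xs , xs! , s+1≤ , cxs≡j) =
    ≤-trans s+1≤ (length≤∣p∣ xs! (All.map (∈-select⁺ (λ v → c v ≟ j)) cxs≡j))
  ... | inj₂ (i , col , mono) =
    ⊥-elim (proper i (col , λ v v∈i → All.lookup mono (∈-fromList⁻ v∈i)))

-- The construction

edgeless : ∀ s → Robust s 0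
edgeless s = record
  { nV = suc s ; nE = 0 ; E = λ () ; E-unique = λ () ; E-length = λ ()
  ; E-separated = λ () ; E-spread = λ ()
  ; degenerate = λ _ _ _ (v , v∈S) → v , v∈S , [] , z≤n , λ ()
  ; colouring = const zero ; colouring-proper = λ ()
  ; robust = λ c j → inj₁ (AtLeast-tabulate (λ v → v) (λ eq → eq) (λ v → single (c v) j))
  ; vertex = zero }
  where
  single : ∀ (a b : Fin 1) → a ≡ b
  single zero zero = refl

module Extend {s d : ℕ} (H : Robust s d) where
  private module H = Robust H

  t L N : ℕ
  t = suc s
  L = H.nV * t
  N = suc (suc (suc d) * L)

  Embedding : Vec (Fin N) L → Set
  Embedding v = Injective _≡_ _≡_ (V.lookup v)

  embedding? : U.Decidable Embedding
  embedding? v = map′ (λ inj {a} {b} → inj a b) (λ inj a b → inj)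
                      (all? λ a → all? λ b → (V.lookup v a ≟ V.lookup v b) →-dec (a ≟ b))

  opaque
    embeddings : List (Vec (Fin N) L)
    embeddings = filter embedding? (vectors (allFin N) L)

  K : ℕ
  K = length embeddings

  embedding : Fin K → Vec (Fin N) L
  embedding k = L.lookup embeddings k

  opaque
    unfolding embeddings

    embedding-injective : ∀ k → Embedding (embedding k)
    embedding-injective k =
      All.lookup (all-filter embedding? (vectors (allFin N) L)) (∈-lookup k)

    embedding-complete : ∀ (f : Fin L → Fin N) → Injective _≡_ _≡_ f →
                         ∃[ k ] embedding k ≡ tabulate f
    embedding-complete f f-inj = Any.index f∈ , sym (lookup-index f∈)
      where
      f∈ : tabulate f ∈ˡ embeddings
      f∈ = ∈-filter⁺ embedding? (∈-vectors ∈-allFin (tabulate f))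
             (λ {a} {b} eq →
                f-inj (trans (sym (lookup∘tabulate f a)) (trans eq (lookup∘tabulate f b))))

  n′ : ℕ
  n′ = N + K * H.nV

  fresh : Fin N → Fin n′
  fresh x = x ↑ˡ (K * H.nV)

  copy : Fin K → Fin H.nV → Fin n′
  copy k w = N ↑ʳ combine k w

  fresh-injective : ∀ {x y} → fresh x ≡ fresh y → x ≡ y
  fresh-injective = ↑ˡ-injective _ _ _

  copy-injective : ∀ {k w k′ w′} → copy k w ≡ copy k′ w′ → k ≡ k′ × w ≡ w′
  copy-injective {k} {w} {k′} {w′} eq = combine-injective k w k′ w′ (↑ʳ-injective N _ _ eq)

  fresh≢copy : ∀ {x k w} → fresh x ≢ copy k w
  fresh≢copy {x} {k} {w} eq
    with () ← trans (sym (splitAt-↑ˡ N x (K * H.nV)))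
                    (trans (cong (splitAt N) eq) (splitAt-↑ʳ N (K * H.nV) (combine k w)))

  m′ : ℕ
  m′ = K * H.nE + K * H.nV

  inner : Fin K → Fin H.nE → Fin m′
  inner k e = combine k e ↑ˡ (K * H.nV)

  attach : Fin K → Fin H.nV → Fin m′
  attach k w = (K * H.nE) ↑ʳ combine k w

  place : Fin K → Fin H.nV → Fin t → Fin N
  place k w i = V.lookup (embedding k) (combine w i)

  block : Fin K → Fin H.nV → List (Fin N)
  block k w = L.tabulate (place k w)

  innerEdge : Fin K → Fin H.nE → List (Fin n′)
  innerEdge k e = L.map (copy k) (H.E e)

  attachEdge : Fin K → Fin H.nV → List (Fin n′)
  attachEdge k w = copy k w ∷ L.map fresh (block k w)

  E : Fin m′ → List (Fin n′)
  E i = [ uncurry innerEdge ∘ remQuot H.nE , uncurry attachEdge ∘ remQuot H.nV ]′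
          (splitAt (K * H.nE) i)

  E-inner : ∀ k e → E (inner k e) ≡ innerEdge k e
  E-inner k e rewrite splitAt-↑ˡ (K * H.nE) (combine k e) (K * H.nV) =
    cong (uncurry innerEdge) (remQuot-combine k e)

  E-attach : ∀ k w → E (attach k w) ≡ attachEdge k w
  E-attach k w rewrite splitAt-↑ʳ (K * H.nE) (K * H.nV) (combine k w) =
    cong (uncurry attachEdge) (remQuot-combine k w)

  data EdgeView : Fin m′ → Set where
    inner-view  : ∀ k e → EdgeView (inner k e)
    attach-view : ∀ k w → EdgeView (attach k w)

  edgeView : ∀ i → EdgeView i
  edgeView i with splitAt (K * H.nE) i in eq
  ... | inj₁ a =
    subst EdgeView (trans (cong (_↑ˡ (K * H.nV)) (combine-remQuot {K} H.nE a)) (splitAt⁻¹-↑ˡ eq))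
          (inner-view _ _)
  ... | inj₂ b =
    subst EdgeView (trans (cong ((K * H.nE) ↑ʳ_) (combine-remQuot {K} H.nV b)) (splitAt⁻¹-↑ʳ eq))
          (attach-view _ _)

  ∈-innerEdge⁻ : ∀ {k e v} → v ∈ˡ innerEdge k e → ∃[ u ] u ∈ˡ H.E e × v ≡ copy k u
  ∈-innerEdge⁻ = ∈-map⁻ (copy _)

  ∈-attachEdge⁻ : ∀ {k w v} → v ∈ˡ attachEdge k w →
                  v ≡ copy k w ⊎ ∃[ x ] x ∈ˡ block k w × v ≡ fresh x
  ∈-attachEdge⁻ (here v≡) = inj₁ v≡
  ∈-attachEdge⁻ (there v∈) = inj₂ (∈-map⁻ fresh v∈)

  NotFresh : Fin n′ → Set
  NotFresh v = ∀ x → v ≢ fresh x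

  copy-notFresh : ∀ {k w} → NotFresh (copy k w)
  copy-notFresh x eq = fresh≢copy (sym eq)

  innerEdge-notFresh : ∀ {k e v} → v ∈ˡ innerEdge k e → NotFresh v
  innerEdge-notFresh v∈ x v≡x =
    let _ , _ , v≡ = ∈-innerEdge⁻ v∈ in fresh≢copy (trans (sym v≡x) v≡)

  notFresh-disjoint : ∀ {vs} (xs : List (Fin N)) → (∀ {v} → v ∈ˡ vs → NotFresh v) →
                      Disjoint vs (L.map fresh xs)
  notFresh-disjoint xs notFresh (v∈vs , v∈xs) =
    let x , _ , v≡ = ∈-map⁻ fresh v∈xs in notFresh v∈vs x v≡

  ∈-block⁻ : ∀ {k w x} → x ∈ˡ block k w → ∃[ i ] x ≡ place k w i
  ∈-block⁻ = ∈-tabulate⁻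

  block-nonempty : ∀ k w → ∃[ x ] x ∈ˡ block k w
  block-nonempty k w = place k w zero , ∈-tabulate⁺ {f = place k w} zero

  block-unique : ∀ k w → Unique (block k w)
  block-unique k w = tabulate⁺ (λ {i} {j} eq → combine-injectiveʳ w i w j (embedding-injective k eq))

  block-length : ∀ k w → length (L.map fresh (block k w)) ≡ t
  block-length k w =
    trans (length-map fresh (block k w)) (length-tabulate (place k w))

  innerEdge-unique : ∀ k e → Unique (innerEdge k e)
  innerEdge-unique k e = map⁺ (proj₂ ∘ copy-injective) (H.E-unique e)

  attachEdge-unique : ∀ k w → Unique (attachEdge k w)
  attachEdge-unique k w =
    All.tabulate (λ v∈ copy≡v → let x , _ , v≡ = ∈-map⁻ fresh v∈
                                in fresh≢copy (sym (trans copy≡v v≡)))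
    ∷ map⁺ fresh-injective (block-unique k w)

  innerEdge-length : ∀ k e → length (innerEdge k e) ≡ 2 + s
  innerEdge-length k e = trans (length-map (copy k) (H.E e)) (H.E-length e)

  attachEdge-length : ∀ k w → length (attachEdge k w) ≡ 2 + s
  attachEdge-length k w = cong suc (block-length k w)

  E-unique : ∀ i → Unique (E i)
  E-unique i with edgeView i
  ... | inner-view k e = subst Unique (sym (E-inner k e)) (innerEdge-unique k e)
  ... | attach-view k w = subst Unique (sym (E-attach k w)) (attachEdge-unique k w)

  E-length : ∀ i → length (E i) ≡ 2 + s
  E-length i with edgeView i
  ... | inner-view k e = trans (cong length (E-inner k e)) (innerEdge-length k e)
  ... | attach-view k w = trans (cong length (E-attach k w)) (attachEdge-length k w)

  notFresh-∉attachEdge : ∀ {k w v} → NotFresh v → v ≢ copy k w → v ∉ˡ attachEdge k w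
  notFresh-∉attachEdge notFresh v≢copy v∈ with ∈-attachEdge⁻ v∈
  ... | inj₁ v≡copy = v≢copy v≡copy
  ... | inj₂ (x , _ , v≡x) = notFresh x v≡x

  copy∉innerEdge : ∀ {k k′ w e} → k ≢ k′ → copy k w ∉ˡ innerEdge k′ e
  copy∉innerEdge k≢k′ v∈ = k≢k′ (proj₁ (copy-injective (proj₂ (proj₂ (∈-innerEdge⁻ v∈)))))

  inner-separated : ∀ k e k′ e′ → inner k e ≢ inner k′ e′ →
                    ∃[ v ] v ∈ˡ innerEdge k′ e′ × v ∉ˡ innerEdge k e
  inner-separated k e k′ e′ i≢i′ with k ≟ k′
  ... | no k≢k′ =
    let u , u∈ = H.E-nonempty e′
    in copy k′ u , ∈-map⁺ (copy k′) u∈ , copy∉innerEdge (≢-sym k≢k′)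
  ... | yes refl with e ≟ e′
  ...   | yes refl = ⊥-elim (i≢i′ refl)
  ...   | no e≢e′ =
    let u , u∈e′ , u∉e = H.E-separated e e′ e≢e′
    in copy k u , ∈-map⁺ (copy k) u∈e′ ,
       λ v∈ → let u′ , u′∈e , copy≡ = ∈-innerEdge⁻ v∈
              in u∉e (subst (_∈ˡ H.E e) (sym (proj₂ (copy-injective copy≡))) u′∈e)

  inner-attach-separated : ∀ k e k′ w′ → ∃[ v ] v ∈ˡ attachEdge k′ w′ × v ∉ˡ innerEdge k e
  inner-attach-separated k e k′ w′ =
    let x , x∈ = block-nonempty k′ w′
    in fresh x , there (∈-map⁺ fresh x∈) , λ x∈′ → innerEdge-notFresh x∈′ x refl

  attach-inner-separated : ∀ k w k′ e′ → ∃[ v ] v ∈ˡ innerEdge k′ e′ × v ∉ˡ attachEdge k w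
  attach-inner-separated k w k′ e′ with H.E-pair e′
  ... | u₁ , u₂ , u₁∈ , u₂∈ , u₁≢u₂ with copy k′ u₁ ≟ copy k w
  ...   | no ≢copy =
    copy k′ u₁ , ∈-map⁺ (copy k′) u₁∈ , notFresh-∉attachEdge copy-notFresh ≢copy
  ...   | yes ≡copy =
    copy k′ u₂ , ∈-map⁺ (copy k′) u₂∈ ,
    notFresh-∉attachEdge copy-notFresh
      (λ ≡copy′ → u₁≢u₂ (proj₂ (copy-injective (trans ≡copy (sym ≡copy′)))))

  attach-separated : ∀ k w k′ w′ → attach k w ≢ attach k′ w′ →
                     ∃[ v ] v ∈ˡ attachEdge k′ w′ × v ∉ˡ attachEdge k w
  attach-separated k w k′ w′ a≢a′ =
    copy k′ w′ , here refl ,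
    notFresh-∉attachEdge copy-notFresh
      (λ copy≡ → a≢a′ (sym (uncurry (cong₂ attach) (copy-injective copy≡))))

  E-separated : ∀ i j → i ≢ j → ∃[ v ] v ∈ˡ E j × v ∉ˡ E i
  E-separated i j i≢j with edgeView i | edgeView j
  ... | inner-view k e | inner-view k′ e′ rewrite E-inner k e | E-inner k′ e′ =
    inner-separated k e k′ e′ i≢j
  ... | inner-view k e | attach-view k′ w′ rewrite E-inner k e | E-attach k′ w′ =
    inner-attach-separated k e k′ w′
  ... | attach-view k w | inner-view k′ e′ rewrite E-attach k w | E-inner k′ e′ =
    attach-inner-separated k w k′ e′
  ... | attach-view k w | attach-view k′ w′ rewrite E-attach k w | E-attach k′ w′ =
    attach-separated k w k′ w′ i≢j

  Spread : List (Fin n′) → List (Fin n′) → List (Fin n′) → Set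
  Spread X Y Z = AtLeast (4 + s) (λ v → v ∈ˡ X ⊎ v ∈ˡ Y ⊎ v ∈ˡ Z)

  spread-swap₁₂ : ∀ {X Y Z} → Spread X Y Z → Spread Y X Z
  spread-swap₁₂ = AtLeast-mono {A = Fin n′} ≤-refl
    λ { (inj₁ v∈) → inj₂ (inj₁ v∈)
      ; (inj₂ (inj₁ v∈)) → inj₁ v∈
      ; (inj₂ (inj₂ v∈)) → inj₂ (inj₂ v∈) }

  spread-swap₂₃ : ∀ {X Y Z} → Spread X Y Z → Spread X Z Y
  spread-swap₂₃ = AtLeast-mono {A = Fin n′} ≤-refl
    λ { (inj₁ v∈) → inj₁ v∈
      ; (inj₂ (inj₁ v∈)) → inj₂ (inj₂ v∈)
      ; (inj₂ (inj₂ v∈)) → inj₂ (inj₁ v∈) }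

  disjoint-spread : ∀ {X Y : List (Fin n′)} → Unique X → Unique Y →
                    length X ≡ 2 + s → length Y ≡ 2 + s → Disjoint X Y →
                    AtLeast (4 + s) (λ v → v ∈ˡ X ⊎ v ∈ˡ Y)
  disjoint-spread X! Y! ∣X∣ ∣Y∣ X#Y =
    AtLeast-mono (subst (4 + s ≤_) (sym (cong₂ _+_ ∣X∣ ∣Y∣)) (s≤s (s≤s (m≤n+m (2 + s) s))))
                 (λ v∈ → v∈) (AtLeast-++ X! Y! X#Y)

  inner-pair-spread : ∀ {k k′} e e′ → k ≢ k′ →
                      AtLeast (4 + s) (λ v → v ∈ˡ innerEdge k e ⊎ v ∈ˡ innerEdge k′ e′)
  inner-pair-spread {k} {k′} e e′ k≢k′ =
    disjoint-spread (innerEdge-unique k e) (innerEdge-unique k′ e′)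
                    (innerEdge-length k e) (innerEdge-length k′ e′)
      λ (v∈ , v∈′) → let _ , _ , v≡ = ∈-innerEdge⁻ v∈′
                     in copy∉innerEdge (≢-sym k≢k′) (subst (_∈ˡ _) v≡ v∈)

  attach-pair-spread : ∀ {k w w′} → w ≢ w′ →
                       AtLeast (4 + s) (λ v → v ∈ˡ attachEdge k w ⊎ v ∈ˡ attachEdge k w′)
  attach-pair-spread {k} {w} {w′} w≢w′ =
    disjoint-spread (attachEdge-unique k w) (attachEdge-unique k w′)
                    (attachEdge-length k w) (attachEdge-length k w′) disjoint
    where
    disjoint : Disjoint (attachEdge k w) (attachEdge k w′)
    disjoint (v∈ , v∈′) with ∈-attachEdge⁻ v∈ | ∈-attachEdge⁻ v∈′
    ... | inj₁ v≡ | inj₁ v≡′ = w≢w′ (proj₂ (copy-injective (trans (sym v≡) v≡′)))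
    ... | inj₁ v≡ | inj₂ (_ , _ , v≡′) = fresh≢copy (trans (sym v≡′) v≡)
    ... | inj₂ (_ , _ , v≡) | inj₁ v≡′ = fresh≢copy (trans (sym v≡) v≡′)
    ... | inj₂ (x , x∈ , v≡) | inj₂ (x′ , x′∈ , v≡′) =
      let i , x≡ = ∈-block⁻ x∈ ; i′ , x′≡ = ∈-block⁻ x′∈
          place≡ = trans (sym x≡) (trans (fresh-injective (trans (sym v≡) v≡′)) x′≡)
      in w≢w′ (proj₁ (combine-injective w i w′ i′ (embedding-injective k place≡)))

  inner-attach-spread : ∀ {u} k e k′ w → u ∉ˡ innerEdge k e → NotFresh u →
                        AtLeast (4 + s) (λ v → v ∈ˡ u ∷ innerEdge k e ⊎ v ∈ˡ L.map fresh (block k′ w))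
  inner-attach-spread k e k′ w u∉ u-notFresh =
    AtLeast-mono (subst (4 + s ≤_)
                        (sym (cong₂ _+_ (cong suc (innerEdge-length k e)) (block-length k′ w)))
                        (s≤s (s≤s (s≤s (m≤n+m (suc s) s)))))
                 (λ v∈ → v∈)
                 (AtLeast-++ (∉⇒All≢ u∉ ∷ innerEdge-unique k e)
                             (map⁺ fresh-injective (block-unique k′ w))
                             (notFresh-disjoint (block k′ w)
                                λ { (here refl) → u-notFresh ; (there v∈) → innerEdge-notFresh v∈ }))

  inner³-spread : ∀ k₁ e₁ k₂ e₂ k₃ e₃ →
                  inner k₁ e₁ ≢ inner k₂ e₂ → inner k₂ e₂ ≢ inner k₃ e₃ → inner k₁ e₁ ≢ inner k₃ e₃ →
                  Spread (innerEdge k₁ e₁) (innerEdge k₂ e₂) (innerEdge k₃ e₃)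
  inner³-spread k₁ e₁ k₂ e₂ k₃ e₃ ≢₁₂ ≢₂₃ ≢₁₃ with k₁ ≟ k₂ | k₂ ≟ k₃
  ... | no k₁≢k₂ | _ =
    AtLeast-mono ≤-refl [ inj₁ , inj₂ ∘ inj₁ ]′ (inner-pair-spread e₁ e₂ k₁≢k₂)
  ... | yes refl | no k₂≢k₃ =
    AtLeast-mono ≤-refl [ inj₂ ∘ inj₁ , inj₂ ∘ inj₂ ]′ (inner-pair-spread e₂ e₃ k₂≢k₃)
  ... | yes refl | yes refl =
    AtLeast-map (copy k₁) (proj₂ ∘ copy-injective)
      (λ { (inj₁ v∈) → inj₁ (∈-map⁺ (copy k₁) v∈)
         ; (inj₂ (inj₁ v∈)) → inj₂ (inj₁ (∈-map⁺ (copy k₁) v∈))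
         ; (inj₂ (inj₂ v∈)) → inj₂ (inj₂ (∈-map⁺ (copy k₁) v∈)) })
      (H.E-spread e₁ e₂ e₃ (≢₁₂ ∘ cong (inner k₁)) (≢₂₃ ∘ cong (inner k₁)) (≢₁₃ ∘ cong (inner k₁)))

  inner²-attach-spread : ∀ k₁ e₁ k₂ e₂ k w → inner k₁ e₁ ≢ inner k₂ e₂ →
                         Spread (innerEdge k₁ e₁) (innerEdge k₂ e₂) (attachEdge k w)
  inner²-attach-spread k₁ e₁ k₂ e₂ k w ≢₁₂ =
    let u , u∈₂ , u∉₁ = inner-separated k₁ e₁ k₂ e₂ ≢₁₂
    in AtLeast-mono ≤-refl
         (λ { (inj₁ (here refl)) → inj₂ (inj₁ u∈₂)
            ; (inj₁ (there v∈)) → inj₁ v∈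
            ; (inj₂ v∈) → inj₂ (inj₂ (there v∈)) })
         (inner-attach-spread k₁ e₁ k w u∉₁ (innerEdge-notFresh u∈₂))

  inner-attach²-spread : ∀ k₁ e₁ k w k′ w′ → attach k w ≢ attach k′ w′ →
                         Spread (innerEdge k₁ e₁) (attachEdge k w) (attachEdge k′ w′)
  inner-attach²-spread k₁ e₁ k w k′ w′ a≢a′ with k ≟ k′ | k ≟ k₁
  ... | yes refl | _ = AtLeast-mono ≤-refl inj₂ (attach-pair-spread (a≢a′ ∘ cong (attach k)))
  ... | no k≢k′ | no k≢k₁ =
    AtLeast-mono ≤-refl
      (λ { (inj₁ (here v≡)) → inj₂ (inj₁ (here v≡))
         ; (inj₁ (there v∈)) → inj₁ v∈
         ; (inj₂ v∈) → inj₂ (inj₁ (there v∈)) })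
      (inner-attach-spread k₁ e₁ k w (copy∉innerEdge k≢k₁) copy-notFresh)
  ... | no k≢k′ | yes refl =
    AtLeast-mono ≤-refl
      (λ { (inj₁ (here v≡)) → inj₂ (inj₂ (here v≡))
         ; (inj₁ (there v∈)) → inj₁ v∈
         ; (inj₂ v∈) → inj₂ (inj₂ (there v∈)) })
      (inner-attach-spread k e₁ k′ w′ (copy∉innerEdge (≢-sym k≢k′)) copy-notFresh)

  attach³-spread : ∀ k₁ w₁ k₂ w₂ k₃ w₃ →
                   attach k₁ w₁ ≢ attach k₂ w₂ → attach k₂ w₂ ≢ attach k₃ w₃ →
                   attach k₁ w₁ ≢ attach k₃ w₃ →
                   Spread (attachEdge k₁ w₁) (attachEdge k₂ w₂) (attachEdge k₃ w₃)
  attach³-spread k₁ w₁ k₂ w₂ k₃ w₃ ≢₁₂ ≢₂₃ ≢₁₃ =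
    AtLeast-mono (≤-reflexive (cong (3 +_) (sym (block-length k₁ w₁))))
      (λ { (inj₁ (here v≡)) → inj₁ (here v≡)
         ; (inj₁ (there (here v≡))) → inj₂ (inj₁ (here v≡))
         ; (inj₁ (there (there (here v≡)))) → inj₂ (inj₂ (here v≡))
         ; (inj₂ v∈) → inj₁ (there v∈) })
      (AtLeast-++ ((copy≢ ≢₁₂ ∷ copy≢ ≢₁₃ ∷ []) ∷ (copy≢ ≢₂₃ ∷ []) ∷ [] ∷ [])
                  (map⁺ fresh-injective (block-unique k₁ w₁))
                  (notFresh-disjoint (block k₁ w₁)
                     λ { (here refl) → copy-notFresh
                       ; (there (here refl)) → copy-notFresh
                       ; (there (there (here refl))) → copy-notFresh }))
    where
    copy≢ : ∀ {k w k′ w′} → attach k w ≢ attach k′ w′ → copy k w ≢ copy k′ w′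
    copy≢ a≢a′ copy≡ = a≢a′ (uncurry (cong₂ attach) (copy-injective copy≡))

  E-spread : ∀ a b c → a ≢ b → b ≢ c → a ≢ c → Spread (E a) (E b) (E c)
  E-spread a b c a≢b b≢c a≢c with edgeView a | edgeView b | edgeView c
  ... | inner-view k₁ e₁ | inner-view k₂ e₂ | inner-view k₃ e₃
    rewrite E-inner k₁ e₁ | E-inner k₂ e₂ | E-inner k₃ e₃ =
      inner³-spread k₁ e₁ k₂ e₂ k₃ e₃ a≢b b≢c a≢c
  ... | inner-view k₁ e₁ | inner-view k₂ e₂ | attach-view k₃ w₃
    rewrite E-inner k₁ e₁ | E-inner k₂ e₂ | E-attach k₃ w₃ =
      inner²-attach-spread k₁ e₁ k₂ e₂ k₃ w₃ a≢b
  ... | inner-view k₁ e₁ | attach-view k₂ w₂ | inner-view k₃ e₃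
    rewrite E-inner k₁ e₁ | E-attach k₂ w₂ | E-inner k₃ e₃ =
      spread-swap₂₃ (inner²-attach-spread k₁ e₁ k₃ e₃ k₂ w₂ a≢c)
  ... | attach-view k₁ w₁ | inner-view k₂ e₂ | inner-view k₃ e₃
    rewrite E-attach k₁ w₁ | E-inner k₂ e₂ | E-inner k₃ e₃ =
      spread-swap₁₂ (spread-swap₂₃ (inner²-attach-spread k₂ e₂ k₃ e₃ k₁ w₁ b≢c))
  ... | inner-view k₁ e₁ | attach-view k₂ w₂ | attach-view k₃ w₃
    rewrite E-inner k₁ e₁ | E-attach k₂ w₂ | E-attach k₃ w₃ =
      inner-attach²-spread k₁ e₁ k₂ w₂ k₃ w₃ b≢c
  ... | attach-view k₁ w₁ | inner-view k₂ e₂ | attach-view k₃ w₃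
    rewrite E-attach k₁ w₁ | E-inner k₂ e₂ | E-attach k₃ w₃ =
      spread-swap₁₂ (inner-attach²-spread k₂ e₂ k₁ w₁ k₃ w₃ a≢c)
  ... | attach-view k₁ w₁ | attach-view k₂ w₂ | inner-view k₃ e₃
    rewrite E-attach k₁ w₁ | E-attach k₂ w₂ | E-inner k₃ e₃ =
      spread-swap₂₃ (spread-swap₁₂ (inner-attach²-spread k₃ e₃ k₁ w₁ k₂ w₂ a≢b))
  ... | attach-view k₁ w₁ | attach-view k₂ w₂ | attach-view k₃ w₃
    rewrite E-attach k₁ w₁ | E-attach k₂ w₂ | E-attach k₃ w₃ =
      attach³-spread k₁ w₁ k₂ w₂ k₃ w₃ a≢b b≢c a≢c

  -- Inside one copy the degeneracy of H applies; a copy vertex gains only its attachment edge.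
  degenerate-at-copy : ∀ S F → Spans E S F → ∀ k w → copy k w ∈ S →
                       ∃[ v ] v ∈ S × DegreeAtMost E (suc d) F v
  degenerate-at-copy S F F⊆S k w copy∈S =
    let u , u∈Sₖ , ys , ys≤d , ys⊇ = H.degenerate Sₖ Fₖ Fₖ⊆Sₖ (w , ∈-select⁺ in-S copy∈S)
    in copy k u , ∈-select⁻ in-S u∈Sₖ ,
       attach k u ∷ L.map (inner k) ys , s≤s (subst (_≤ d) (sym (length-map (inner k) ys)) ys≤d) ,
       covers u ys ys⊇
    where
    in-S : U.Decidable (λ u → copy k u ∈ S)
    in-S u = copy k u ∈? S

    in-F : U.Decidable (λ e → inner k e ∈ F)
    in-F e = inner k e ∈? F

    Sₖ : Subset H.nV
    Sₖ = tabulate (does ∘ in-S)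

    Fₖ : Subset H.nE
    Fₖ = tabulate (does ∘ in-F)

    Fₖ⊆Sₖ : Spans H.E Sₖ Fₖ
    Fₖ⊆Sₖ e e∈Fₖ =
      All.map (∈-select⁺ in-S)
        (AllP.map⁻ (subst (All (_∈ S)) (E-inner k e) (F⊆S (inner k e) (∈-select⁻ in-F e∈Fₖ))))

    covers : ∀ u ys → (∀ e → e ∈ Fₖ → u ∈ˡ H.E e → e ∈ˡ ys) →
             ∀ i → i ∈ F → copy k u ∈ˡ E i → i ∈ˡ attach k u ∷ L.map (inner k) ys
    covers u ys ys⊇ i i∈F u∈i with edgeView i
    ... | inner-view k′ e with ∈-innerEdge⁻ (subst (copy k u ∈ˡ_) (E-inner k′ e) u∈i)
    ...   | u′ , u′∈e , copy≡ with copy-injective copy≡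
    ...     | refl , refl = there (∈-map⁺ (inner k) (ys⊇ e (∈-select⁺ in-F i∈F) u′∈e))
    covers u ys ys⊇ i i∈F u∈i | attach-view k′ w′
      with ∈-attachEdge⁻ (subst (copy k u ∈ˡ_) (E-attach k′ w′) u∈i)
    ...   | inj₁ copy≡ with copy-injective copy≡
    ...     | refl , refl = here refl
    covers u ys ys⊇ i i∈F u∈i | attach-view k′ w′ | inj₂ (_ , _ , copy≡fresh) =
      ⊥-elim (fresh≢copy (sym copy≡fresh))

  -- Every edge contains a copy vertex, so without one in S the edge set F is empty.
  degenerate : ∀ S F → Spans E S F → Nonempty S → ∃[ v ] v ∈ S × DegreeAtMost E (suc d) F v
  degenerate S F F⊆S (v , v∈S) with any? (λ k → any? (λ w → copy k w ∈? S))
  ... | yes (k , w , copy∈S) = degenerate-at-copy S F F⊆S k w copy∈S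
  ... | no no-copy = v , v∈S , [] , z≤n , λ i i∈F _ → ⊥-elim (no-copy (copy-in-edge i i∈F))
    where
    copy-in-edge : ∀ i → i ∈ F → ∃[ k ] ∃[ w ] copy k w ∈ S
    copy-in-edge i i∈F with edgeView i
    ... | inner-view k e =
      let u , u∈e = H.E-nonempty e
      in k , u , All.lookup (subst (All (_∈ S)) (E-inner k e) (F⊆S _ i∈F)) (∈-map⁺ (copy k) u∈e)
    ... | attach-view k w =
      k , w , All.lookup (subst (All (_∈ S)) (E-attach k w) (F⊆S _ i∈F)) (here refl)

  colouring : Fin n′ → Fin (suc (suc d))
  colouring v = [ const zero , suc ∘ H.colouring ∘ proj₂ ∘ remQuot {K} H.nV ]′ (splitAt N v)

  colouring-fresh : ∀ x → colouring (fresh x) ≡ zero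
  colouring-fresh x rewrite splitAt-↑ˡ N x (K * H.nV) = refl

  colouring-copy : ∀ k w → colouring (copy k w) ≡ suc (H.colouring w)
  colouring-copy k w rewrite splitAt-↑ʳ N (K * H.nV) (combine k w) =
    cong (suc ∘ H.colouring ∘ proj₂) (remQuot-combine k w)

  colouring-proper : ∀ i → ¬ Monochromatic E colouring i
  colouring-proper i (col , mono) with edgeView i
  ... | inner-view k e =
    inner-not-mono col (AllP.map⁻ (subst (All (λ v → colouring v ≡ col)) (E-inner k e) mono))
    where
    inner-not-mono : ∀ col → ¬ All (λ u → colouring (copy k u) ≡ col) (H.E e)
    inner-not-mono zero all≡0 =
      let u , u∈e = H.E-nonempty e in 0≢1+n (trans (sym (All.lookup all≡0 u∈e)) (colouring-copy k u))
    inner-not-mono (suc col) all≡ =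
      H.colouring-proper e
        (col , All.map (λ {u} c≡ → suc-injective (trans (sym (colouring-copy k u)) c≡)) all≡)
  ... | attach-view k w with subst (All (λ v → colouring v ≡ col)) (E-attach k w) mono
  ...   | copy≡col ∷ fresh≡col =
    let x , x∈ = block-nonempty k w
    in 0≢1+n (trans (sym (colouring-fresh x))
                    (trans (All.lookup fresh≡col (∈-map⁺ fresh x∈))
                           (trans (sym copy≡col) (colouring-copy k w))))

  -- (d + 2) L < N, so some colour j₀ occurs on L fresh vertices, enough to fill the blocks of a copy.
  large-fresh-class : ∀ (c : Fin n′ → Fin (suc (suc d))) →
                      ∃[ j₀ ] Σ (Fin L → Fin N) λ f → Injective _≡_ _≡_ f × (∀ a → c (fresh (f a)) ≡ j₀)
  large-fresh-class c =
    let j , j<q , L≤ = pigeonhole L (suc (suc d)) colour (allFin N) colour< N-large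
    in F.fromℕ< j<q , (λ a → L.lookup (class j) (F.inject≤ a L≤)) ,
       (λ {a} {b} eq → inject≤-injective _ _ a b
                         (lookup-injective (UniqueP.filter⁺ (is j) (allFin⁺ N)) _ _ eq)) ,
       (λ a → toℕ-injective (trans (All.lookup (all-filter (is j) (allFin N)) (∈-lookup _))
                                   (sym (toℕ-fromℕ< j<q))))
    where
    colour : Fin N → ℕ
    colour x = F.toℕ (c (fresh x))

    colour< : All (λ x → colour x < suc (suc d)) (allFin N)
    colour< = All.universal (λ x → toℕ<n (c (fresh x))) _

    N-large : suc (suc d) * L < length (allFin N)
    N-large = subst (suc (suc d) * L <_) (sym (length-tabulate {n = N} (λ x → x))) ≤-refl

    is : ∀ j → U.Decidable (λ x → colour x ≡ j)
    is j x = colour x ℕ.≟ j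

    class : ℕ → List (Fin N)
    class j = filter (is j) (allFin N)

  robust-in-copy : ∀ (c : Fin n′ → Fin (suc (suc d))) k {j₀ j} → j₀ ≢ j →
                   (∀ w → All (λ x → c (fresh x) ≡ j₀) (block k w)) →
                   AtLeast (suc s) (λ v → c v ≡ j) ⊎ ∃ (Monochromatic E c)
  robust-in-copy c k {j₀} {j} j₀≢j blocks≡j₀ with any? (λ w → c (copy k w) ≟ j₀)
  ... | yes (w , copy≡j₀) =
    inj₂ (attach k w , j₀ ,
          subst (All (λ v → c v ≡ j₀)) (sym (E-attach k w)) (copy≡j₀ ∷ AllP.map⁺ (blocks≡j₀ w)))
  ... | no avoids-j₀ with H.robust cₖ (punchOut j₀≢j)
    where
    cₖ : Fin H.nV → Fin (suc d)
    cₖ w = punchOut {i = j₀} {j = c (copy k w)} (λ j₀≡ → avoids-j₀ (w , sym j₀≡))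
  ...   | inj₁ many =
    inj₁ (AtLeast-map (copy k) (proj₂ ∘ copy-injective)
            (λ {w} cₖw≡ → punchOut-injective {i = j₀} _ j₀≢j cₖw≡) many)
  ...   | inj₂ (e , col , mono) =
    inj₂ (inner k e , punchIn j₀ col ,
          subst (All (λ v → c v ≡ punchIn j₀ col)) (sym (E-inner k e))
            (AllP.map⁺ (All.map (λ cₖ≡ → trans (sym (punchIn-punchOut _)) (cong (punchIn j₀) cₖ≡))
                                mono)))

  robust : ∀ (c : Fin n′ → Fin (suc (suc d))) j →
           AtLeast (suc s) (λ v → c v ≡ j) ⊎ ∃ (Monochromatic E c)
  robust c j with large-fresh-class c
  ... | j₀ , f , f-inj , f≡j₀ with j₀ ≟ j
  ...   | yes refl =
    inj₁ (AtLeast-tabulate (λ i → fresh (f (combine H.vertex i)))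
            (λ eq → combine-injectiveʳ H.vertex _ H.vertex _ (f-inj (fresh-injective eq)))
            (λ i → f≡j₀ _))
  ...   | no j₀≢j =
    let k , embedding≡f = embedding-complete f f-inj
    in robust-in-copy c k j₀≢j λ w →
         AllP.tabulate⁺ λ i →
           trans (cong (λ v → c (fresh (V.lookup v (combine w i)))) embedding≡f)
                 (trans (cong (c ∘ fresh) (lookup∘tabulate f (combine w i))) (f≡j₀ _))

extend : ∀ {s d} → Robust s d → Robust s (suc d)
extend H = record
  { nV = n′ ; nE = m′ ; E = E ; E-unique = E-unique ; E-length = E-length
  ; E-separated = E-separated ; E-spread = E-spread ; degenerate = degenerate
  ; colouring = colouring ; colouring-proper = colouring-proper ; robust = robust
  ; vertex = fresh zero }
  where open Extend H

robustHypergraph : ∀ s d → Robust s d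
robustHypergraph s zero = edgeless s
robustHypergraph s (suc d) = extend (robustHypergraph s d)

lemma4 : (r : ℕ) → r ≥ 2 → (d : ℕ) → d ≥ 1 →
    Σ Hypergraph λ G →
      TriangleFree r G × Degenerate d G × Uniform r G ×
      ChromaticNumber G (d + 1) ×
      (∀ (c : Fin (n G) → Fin (d + 1)) → IsColouring G (d + 1) c →
        ∀ (j : Fin (d + 1)) → ∣ colourClass G c j ∣ ≥ r ∸ 1)
-- The construction works for d = 0 as well.
lemma4 (suc (suc s)) _ d _ rewrite +-comm d 1 =
  hypergraph , triangleFree , degenerate′ , uniform , (colourable , not-colourable) , colourClasses-large
  where open ToHypergraph (robustHypergraph s d)
lemma4 (suc zero) (s≤s ()) _ _
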